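{- Let $G$ be a graph with vertex set $V=\{v_1,\dots,v_n\}$ such that $V_c=\{v_1,\dots,v_k\}$ is a vertex cover of $G$, and let $l$ be a positive integer. Let $\bar{E}(V_c)$ be the set of pairs $v_iv_j$ with $1\le i<j\le k$ and $v_iv_j\notin E(G)$. Construct $G'$ as follows: $L=\{v'_1,\dots,v'_k\}\cup\{a_1,a_2\}$ is a clique; $R=\{v''_1,\dots,v''_k\}\cup\{b_1,b_2,u\}$ is a clique; $a_1b_1$, $a_2b_2$ and $v'_iv''_i$ ($i\in[k]$) are edges; $F=\{v'_{k+1},\dots,v'_n\}$ is a set of new vertices each adjacent to $u$, and $v'_{k+i}\in F$ is adjacent to $v''_j$ ($j\in[k]$) whenever $v_{k+i}$ and $v_j$ are non-adjacent in $G$; finally, for each $v_iv_j\in\bar{E}(V_c)$ with $i<j$ there are four new vertices $e^1_{ij},e^2_{ij},e^3_{ij},e^4_{ij}$ forming the path $e^1_{ij}e^2_{ij}e^3_{ij}e^4_{ij}$, with $v''_i$ adjacent to $e^1_{ij}$ and $e^4_{ij}$, and $v''_j$ adjacent to $e^2_{ij}$ and $e^3_{ij}$. There are no other edges. Then $G$ has a clique of size $l$ if and only if $G'$ has a pair of perfectly matched sets of size $2+2|\bar{E}(V_c)|+l$.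
   Context: All graphs are finite, simple and undirected. A vertex cover of $G$ is a set of vertices containing at least one endpoint of every edge. In a graph, a pair $(A,B)$ is a pair of perfectly matched sets if $A$ and $B$ are disjoint vertex subsets, every vertex of $A$ has exactly one neighbor in $B$, and every vertex of $B$ has exactly one neighbor in $A$; its size is $|A|=|B|$. -}

module Defs where

open import Data.Nat using (ℕ; zero; suc; _+_; _*_; _<_; _<ᵇ_; _≡ᵇ_)
open import Data.Bool using (Bool; true; false; not; _∧_; _∨_; T; if_then_else_)
open import Data.Fin using (Fin; toℕ; _↑ˡ_; _↑ʳ_; _≟_)
open import Data.List using (List; length; map; allFin)
open import Data.Nat.ListAction using (sum)
open import Data.List.Relation.Unary.Unique.Propositional using (Unique)
open import Data.List.Membership.Propositional using (_∈_; _∉_)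
open import Data.Product using (Σ; ∃; _×_; _,_)
open import Data.Sum using (_⊎_)
open import Relation.Nullary using (¬_)
open import Relation.Nullary.Decidable using (⌊_⌋)
open import Relation.Binary.PropositionalEquality using (_≡_; _≢_)
open import Function.Definitions using (Injective)

-- A finite simple undirected graph on vertex set Fin n (vertex i ↔ v_{i+1}),
-- with decidable (Bool-valued) adjacency.
record Graph (n : ℕ) : Set where
  field
    adj    : Fin n → Fin n → Bool
    sym    : ∀ i j → adj i j ≡ adj j i
    irrefl : ∀ i → adj i i ≡ false
open Graph public

-- G on k + m vertices; V_c = {v_1..v_k} are the vertices i ↑ˡ m (i : Fin k),
-- the remaining ones v_{k+1}..v_{k+m} are k ↑ʳ j (j : Fin m).
-- "V_c is a vertex cover": every edge has an endpoint with index < k.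
FirstIsVertexCover : ∀ {k m} → Graph (k + m) → Set
FirstIsVertexCover {k} G = ∀ x y → T (adj G x y) → toℕ x < k ⊎ toℕ y < k

HasClique : ∀ {n} → Graph n → ℕ → Set
HasClique {n} G l =
  Σ (Fin l → Fin n) λ f → Injective _≡_ _≡_ f × (∀ i j → i ≢ j → T (adj G (f i) (f j)))

module Construction {k m : ℕ} (G : Graph (k + m)) where

  adjC : Fin k → Fin k → Bool
  adjC i j = adj G (i ↑ˡ m) (j ↑ˡ m)

  nonEdge : Fin k → Fin k → Bool
  nonEdge i j = (toℕ i <ᵇ toℕ j) ∧ not (adjC i j)

  nonEdgeCount : ℕ
  nonEdgeCount = sum (map (λ i → sum (map (λ j → if nonEdge i j then 1 else 0) (allFin k))) (allFin k))

  data V′ : Set where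
    vL  : Fin k → V′
    a₁ a₂ : V′
    vR  : Fin k → V′
    b₁ b₂ u : V′
    vF  : Fin m → V′        -- v'_{k+j} ∈ F
    e   : Fin 4 → (i j : Fin k) → T (nonEdge i j) → V′   -- e^{t+1}_{ij}

  eqF : ∀ {p} → Fin p → Fin p → Bool
  eqF i j = ⌊ i ≟ j ⌋

  -- generating (one-directional) edge list of G'
  D : V′ → V′ → Bool
  D (vL i) (vL j) = not (eqF i j)
  D (vL i) a₁ = true
  D (vL i) a₂ = true
  D a₁ a₂ = true
  D (vR i) (vR j) = not (eqF i j)
  D (vR i) b₁ = true
  D (vR i) b₂ = true
  D (vR i) u = true
  D b₁ b₂ = true
  D b₁ u = true
  D b₂ u = true
  D a₁ b₁ = true
  D a₂ b₂ = true
  D (vL i) (vR j) = eqF i j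
  D (vF j) u = true
  D (vF j) (vR i) = not (adj G (k ↑ʳ j) (i ↑ˡ m))
  D (e t i j _) (e t′ i′ j′ _) = eqF i i′ ∧ eqF j j′ ∧ (toℕ t′ ≡ᵇ suc (toℕ t))
  D (vR r) (e t i j _) =
    (eqF r i ∧ ((toℕ t ≡ᵇ 0) ∨ (toℕ t ≡ᵇ 3))) ∨ (eqF r j ∧ ((toℕ t ≡ᵇ 1) ∨ (toℕ t ≡ᵇ 2)))
  D _ _ = false

  E′ : V′ → V′ → Set
  E′ x y = T (D x y ∨ D y x)

ExactlyOneNbrIn : {V : Set} → (V → V → Set) → V → List V → Set
ExactlyOneNbrIn {V} E x S = Σ V λ y → y ∈ S × E x y × (∀ z → z ∈ S → E x z → z ≡ y)

-- (A , B) is a pair of perfectly matched sets of size s (finite vertex sets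
-- represented as duplicate-free lists)
IsPMS : {V : Set} → (V → V → Set) → List V → List V → ℕ → Set
IsPMS E A B s =
  Unique A × Unique B × length A ≡ s × length B ≡ s ×
  (∀ x → x ∈ A → x ∉ B) ×
  (∀ x → x ∈ A → ExactlyOneNbrIn E x B) ×
  (∀ y → y ∈ B → ExactlyOneNbrIn E y A)

HasPMS : {V : Set} → (V → V → Set) → ℕ → Set
HasPMS {V} E s = Σ (List V) λ A → Σ (List V) λ B → IsPMS E A B s

-- A clique of G has at most one vertex v_{k+t} outside the vertex cover V_c. For a clique C, let A consist of
-- a₁, a₂, the v′_i with v_i ∈ C and v′_{k+t} if v_{k+t} ∈ C, and B of b₁, b₂, the v″_i with v_i ∈ C and u if
-- v_{k+t} ∈ C. The path of the gadget of a non-edge v_iv_j is matched as e¹e², e³e⁴, with e², e³ in A if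
-- v_i ∈ C and e¹, e⁴ in A otherwise; as v_i and v_j are not both in C, no v″ in B sees a gadget vertex of A.
--
-- Conversely, let K be the set of i with v″_i ∈ B such that v_i is adjacent to every v_j with j < i and
-- v″_j ∈ B, and F the set of t with v′_{k+t} ∈ A and u ∈ B; K ∪ F indexes a clique of G. Each matched pair
-- is charged injectively to one of a₁, a₂, the v′_i with i ∈ K, the v′_{k+t} with t ∈ F and the middle
-- vertices e², e³ of the gadgets. As L and R are cliques, at most one pair lies in L or ends at b₁ (charged
-- to a₁) and, after possibly swapping A and B, at most one starts in R or ends at b₂ (charged to a₂). A pair
-- ending at v″_i with i ∉ K is charged to the gadget of the offending non-edge v_jv_i, which contains no
-- matched pair since v″_j and v″_i both lie in B; a pair inside a gadget is charged to a middle endpoint.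

module Submission where

open import Defs renaming (sym to adj-sym)
open import Data.Bool as Bool using (Bool; true; false; not; _∧_; _∨_; T; if_then_else_)
open import Data.Bool.Properties using (T?; T-irrelevant; T-∧; T-∨; ∨-comm; ∨-identityʳ; ¬-not)
open import Data.Empty using (⊥; ⊥-elim)
open import Data.Fin as Fin using (Fin; zero; suc; toℕ; _↑ˡ_; _↑ʳ_; #_; splitAt)
open import Data.Fin.Properties
  using (toℕ-injective; toℕ-↑ʳ; toℕ<n; suc-injective; ↑ˡ-injective; ↑ʳ-injective; inject≤-injective;
         splitAt⁻¹-↑ˡ; splitAt⁻¹-↑ʳ; injective⇒≤; any?)
open import Data.List
  using (List; []; _∷_; _++_; length; map; concatMap; filter; filterᵇ; lookup; allFin; tabulate; upTo)
open import Data.List.Properties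
  using (length-++; length-map; length-tabulate; filter-++; map-cong; ∷-injectiveˡ; ∷-injectiveʳ; ≡-dec)
open import Data.List.Membership.Propositional using (_∈_; _∉_; find; lose)
open import Data.List.Membership.Propositional.Properties
  using (∈-lookup; ∈-concatMap⁺; ∈-concatMap⁻; ∈-allFin; ∈-upTo⁺; ∈-map⁺; ∈-map⁻; ∈-filter⁺; ∈-filter⁻;
         ∈-++⁺ˡ; ∈-++⁺ʳ; ∈-++⁻; ∈-tabulate⁺; ∈-tabulate⁻)
open import Data.List.Relation.Binary.Subset.Propositional using (_⊆_)
open import Data.List.Relation.Unary.All as All using (All; []; _∷_)
open import Data.List.Relation.Unary.AllPairs as AllPairs using ([]; _∷_)
import Data.List.Relation.Unary.All.Properties as AllP
import Data.List.Relation.Unary.AllPairs.Properties as APP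
import Data.List.Relation.Unary.Unique.Propositional.Properties as UP
open import Data.List.Relation.Unary.Any as Any using (here; there)
open import Data.List.Relation.Unary.Any.Properties using (lookup-index)
open import Data.List.Relation.Unary.Unique.Propositional using (Unique)
open import Data.Nat as ℕ using (ℕ; suc; _+_; _*_; _≤_; _<_; _≡ᵇ_)
open import Data.Nat.ListAction using (sum)
open import Data.Nat.Tactic.RingSolver using (solve-∀)
open import Data.Nat.Properties
  using (≤-antisym; m≤m+n; <⇒≱; <-irrefl; <-cmp; <ᵇ⇒<; <⇒<ᵇ; +-cancelˡ-≤; *-distribˡ-+; *-zeroʳ; *-identityʳ)
open import Data.Product using (Σ; ∃; ∃₂; _×_; _,_; proj₁; proj₂)
open import Data.Sum using (_⊎_; inj₁; inj₂)
open import Function using (_∘_)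
open import Function.Definitions using (Injective)
open import Relation.Binary.PropositionalEquality
open import Relation.Nullary using (¬_; ¬?; Dec; yes; no; _×-dec_)
open import Relation.Nullary.Decidable using (⌊_⌋; toWitness; fromWitness; fromWitnessFalse; map′)
open import Relation.Binary.Definitions using (DecidableEquality; tri<; tri≈; tri>)
open import Function.Bundles using (Equivalence; _⇔_; mk⇔)

T-∧⁻ : ∀ {a b} → T (a ∧ b) → T a × T b
T-∧⁻ = Equivalence.to T-∧

T-∧⁺ : ∀ {a b} → T a → T b → T (a ∧ b)
T-∧⁺ ta tb = Equivalence.from T-∧ (ta , tb)

T-∨⁻ : ∀ {a b} → T (a ∨ b) → T a ⊎ T b
T-∨⁻ = Equivalence.to T-∨

T-∨⁺ : ∀ {a b} → T a ⊎ T b → T (a ∨ b)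
T-∨⁺ = Equivalence.from T-∨

T-∨-false⁻ : ∀ {a} → T (a ∨ false) → T a
T-∨-false⁻ = subst T (∨-identityʳ _)

¬T⇒T-not : ∀ {a} → ¬ T a → T (not a)
¬T⇒T-not {true} ¬a = ¬a _
¬T⇒T-not {false} _ = _

T-not : ∀ {a} → T a → T (not a) → ⊥
T-not {true} _ ()

module _ {A : Set} where

  lookup-injective : {xs : List A} → Unique xs → ∀ i j → lookup xs i ≡ lookup xs j → i ≡ j
  lookup-injective {_ ∷ _} _ zero zero _ = refl
  lookup-injective {_ ∷ _} (x∉ ∷ _) zero (suc j) eq = ⊥-elim (All.lookup x∉ (∈-lookup j) eq)
  lookup-injective {_ ∷ _} (x∉ ∷ _) (suc i) zero eq = ⊥-elim (All.lookup x∉ (∈-lookup i) (sym eq))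
  lookup-injective {_ ∷ _} (_ ∷ u) (suc i) (suc j) eq = cong suc (lookup-injective u i j eq)

  injection⇒length≤ : {B : Set} {xs : List A} {ys : List B} → Unique xs →
    (f : ∀ {x} → x ∈ xs → B) →
    (∀ {x x′} (p : x ∈ xs) (p′ : x′ ∈ xs) → f p ≡ f p′ → x ≡ x′) →
    (∀ {x} (p : x ∈ xs) → f p ∈ ys) → length xs ≤ length ys
  injection⇒length≤ {ys = ys} u f f-inj f∈ = injective⇒≤ position-injective
    where
    position : ∀ i → Fin (length ys)
    position i = Any.index (f∈ (∈-lookup i))

    position-injective : Injective _≡_ _≡_ position
    position-injective {i} {j} eq = lookup-injective u i j (f-inj _ _ (begin
      f (∈-lookup i)           ≡⟨ lookup-index (f∈ (∈-lookup i)) ⟩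
      lookup ys (position i)   ≡⟨ cong (lookup ys) eq ⟩
      lookup ys (position j)   ≡⟨ lookup-index (f∈ (∈-lookup j)) ⟨
      f (∈-lookup j)           ∎))
      where open ≡-Reasoning

  ⊆⇒length≤ : {xs ys : List A} → Unique xs → xs ⊆ ys → length xs ≤ length ys
  ⊆⇒length≤ u xs⊆ys = injection⇒length≤ u (λ {x} _ → x) (λ _ _ eq → eq) xs⊆ys

  ⊇⊆⇒length≡ : {xs ys : List A} → Unique xs → Unique ys → xs ⊆ ys → ys ⊆ xs →
    length xs ≡ length ys
  ⊇⊆⇒length≡ uxs uys xs⊆ys ys⊆xs = ≤-antisym (⊆⇒length≤ uxs xs⊆ys) (⊆⇒length≤ uys ys⊆xs)

  length-filterᵇ-++ : (p : A → Bool) (xs ys : List A) →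
    length (filterᵇ p (xs ++ ys)) ≡ length (filterᵇ p xs) + length (filterᵇ p ys)
  length-filterᵇ-++ p xs ys = trans (cong length (filter-++ (T? ∘ p) xs ys)) (length-++ (filterᵇ p xs))

  length-filterᵇ-concatMap : {B : Set} (p : A → Bool) (f : B → List A) (xs : List B) →
    length (filterᵇ p (concatMap f xs)) ≡ sum (map (λ x → length (filterᵇ p (f x))) xs)
  length-filterᵇ-concatMap p f [] = refl
  length-filterᵇ-concatMap p f (x ∷ xs) =
    trans (length-filterᵇ-++ p (f x) (concatMap f xs)) (cong (_ +_) (length-filterᵇ-concatMap p f xs))

  length-filterᵇ-map : {B : Set} (p : A → Bool) (f : B → A) (xs : List B) →
    length (filterᵇ p (map f xs)) ≡ length (filterᵇ (p ∘ f) xs)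
  length-filterᵇ-map p f [] = refl
  length-filterᵇ-map p f (x ∷ xs) with p (f x)
  ... | true  = cong suc (length-filterᵇ-map p f xs)
  ... | false = length-filterᵇ-map p f xs

  length-filterᵇ-false : (xs : List A) → length (filterᵇ (λ _ → false) xs) ≡ 0
  length-filterᵇ-false [] = refl
  length-filterᵇ-false (_ ∷ xs) = length-filterᵇ-false xs

  Unique-concatMap : {B : Set} (f : B → List A) {xs : List B} → Unique xs → All (Unique ∘ f) xs →
    (∀ {x x′ y} → y ∈ f x → y ∈ f x′ → x ≡ x′) → Unique (concatMap f xs)
  Unique-concatMap f uxs ufs index = UP.concat⁺ (AllP.map⁺ ufs)
    (APP.map⁺ (AllPairs.map (λ x≢x′ {_} (y∈ , y∈′) → x≢x′ (index y∈ y∈′)) uxs))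

sum-map-*ˡ : {A : Set} (c : ℕ) (f : A → ℕ) (xs : List A) →
  sum (map (λ x → c * f x) xs) ≡ c * sum (map f xs)
sum-map-*ˡ c f [] = sym (*-zeroʳ c)
sum-map-*ˡ c f (x ∷ xs) = trans (cong (c * f x +_) (sum-map-*ˡ c f xs)) (sym (*-distribˡ-+ c (f x) _))

ifT : {X : Set} (b : Bool) → (T b → List X) → List X
ifT true xs = xs _
ifT false _ = []

module _ {X : Set} where

  ∈-ifT⁺ : ∀ {x} b {xs : T b → List X} (q : T b) → x ∈ xs q → x ∈ ifT b xs
  ∈-ifT⁺ true _ x∈ = x∈

  ∈-ifT⁻ : ∀ {x} b {xs : T b → List X} → x ∈ ifT b xs → Σ (T b) λ q → x ∈ xs q
  ∈-ifT⁻ true x∈ = _ , x∈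

  Unique-ifT : ∀ b {xs : T b → List X} → (∀ q → Unique (xs q)) → Unique (ifT b xs)
  Unique-ifT true u = u _
  Unique-ifT false u = []

↑ˡ≢↑ʳ : ∀ {k m} (i : Fin k) (t : Fin m) → i ↑ˡ m ≢ k ↑ʳ t
↑ˡ≢↑ʳ zero t ()
↑ˡ≢↑ʳ (suc i) t eq = ↑ˡ≢↑ʳ i t (suc-injective eq)

toℕ-↑ʳ≮ : ∀ k {m} (t : Fin m) → ¬ toℕ (k ↑ʳ t) < k
toℕ-↑ʳ≮ k t lt = <⇒≱ lt (subst (k ≤_) (sym (toℕ-↑ʳ k t)) (m≤m+n k (toℕ t)))

combine : ∀ {k m} → List (Fin k) → List (Fin m) → List (Fin (k + m))
combine {k} {m} is ts = map (_↑ˡ m) is ++ map (k ↑ʳ_) ts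

Unique-combine : ∀ {k m} {is : List (Fin k)} {ts : List (Fin m)} → Unique is → Unique ts →
  Unique (combine is ts)
Unique-combine {k} {m} {is} {ts} uis uts =
  UP.++⁺ (UP.map⁺ (↑ˡ-injective m _ _) uis) (UP.map⁺ (↑ʳ-injective k _ _) uts) disjoint
  where
  disjoint : ∀ {v} → ¬ (v ∈ map (_↑ˡ m) is × v ∈ map (k ↑ʳ_) ts)
  disjoint (v∈is , v∈ts) with ∈-map⁻ (_↑ˡ m) v∈is | ∈-map⁻ (k ↑ʳ_) v∈ts
  ... | i , _ , refl | t , _ , eq = ↑ˡ≢↑ʳ i t eq

∈-combine⁻ : ∀ {k m} {is : List (Fin k)} {ts : List (Fin m)} {v} → v ∈ combine is ts →
  (∃ λ i → i ∈ is × v ≡ i ↑ˡ m) ⊎ (∃ λ t → t ∈ ts × v ≡ k ↑ʳ t)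
∈-combine⁻ {k} {m} {is} v∈ with ∈-++⁻ (map (_↑ˡ m) is) v∈
... | inj₁ v∈is = inj₁ (∈-map⁻ (_↑ˡ m) v∈is)
... | inj₂ v∈ts = inj₂ (∈-map⁻ (k ↑ʳ_) v∈ts)

length-combine : ∀ {k m} (is : List (Fin k)) (ts : List (Fin m)) →
  length (combine is ts) ≡ length is + length ts
length-combine {k} {m} is ts =
  trans (length-++ (map (_↑ˡ m) is)) (cong₂ _+_ (length-map (_↑ˡ m) is) (length-map (k ↑ʳ_) ts))

IsCliqueList : ∀ {n} → Graph n → List (Fin n) → Set
IsCliqueList G Q = Unique Q × (∀ {a b} → a ∈ Q → b ∈ Q → a ≢ b → T (adj G a b))

cliqueList⇒HasClique : ∀ {n} (G : Graph n) {Q} → IsCliqueList G Q →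
  ∀ {l} → l ≤ length Q → HasClique G l
cliqueList⇒HasClique G {Q} (uQ , Q-adj) l≤ = vertex , vertex-injective , λ i j i≢j →
  Q-adj (∈-lookup _) (∈-lookup _) (i≢j ∘ vertex-injective)
  where
  vertex = λ i → lookup Q (Fin.inject≤ i l≤)
  vertex-injective : Injective _≡_ _≡_ vertex
  vertex-injective {i} {j} eq = inject≤-injective l≤ l≤ i j (lookup-injective uQ _ _ eq)

module Matched {V : Set} (E : V → V → Set) (E-sym : ∀ {x y} → E x y → E y x) {A B : List V}
  (A∩B≡∅ : ∀ x → x ∈ A → x ∉ B)
  (one-in-B : ∀ x → x ∈ A → ExactlyOneNbrIn E x B)
  (one-in-A : ∀ y → y ∈ B → ExactlyOneNbrIn E y A) where

  mate : ∀ {x} → x ∈ A → V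
  mate {x} x∈A = proj₁ (one-in-B x x∈A)

  mate∈B : ∀ {x} (x∈A : x ∈ A) → mate x∈A ∈ B
  mate∈B {x} x∈A = proj₁ (proj₂ (one-in-B x x∈A))

  mate-adj : ∀ {x} (x∈A : x ∈ A) → E x (mate x∈A)
  mate-adj {x} x∈A = proj₁ (proj₂ (proj₂ (one-in-B x x∈A)))

  mate-unique : ∀ {x z} (x∈A : x ∈ A) → z ∈ B → E x z → z ≡ mate x∈A
  mate-unique {x} x∈A z∈B = proj₂ (proj₂ (proj₂ (one-in-B x x∈A))) _ z∈B

  mate-injective : ∀ {x x′} (x∈A : x ∈ A) (x′∈A : x′ ∈ A) → mate x∈A ≡ mate x′∈A → x ≡ x′
  mate-injective {x} {x′} x∈A x′∈A eq with one-in-A (mate x∈A) (mate∈B x∈A)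
  ... | _ , _ , _ , unique = trans (unique x x∈A (E-sym (mate-adj x∈A)))
    (sym (unique x′ x′∈A (E-sym (subst (E x′) (sym eq) (mate-adj x′∈A)))))

  mate≢ : ∀ {x x′} (x∈A : x ∈ A) → x′ ∈ A → mate x∈A ≢ x′
  mate≢ x∈A x′∈A refl = A∩B≡∅ _ x′∈A (mate∈B x∈A)

  adjacent-to-mate : ∀ {x x′} (x∈A : x ∈ A) (x′∈A : x′ ∈ A) → E x (mate x′∈A) → x ≡ x′
  adjacent-to-mate x∈A x′∈A adj = mate-injective x∈A x′∈A (sym (mate-unique x∈A (mate∈B x′∈A) adj))

  shared-vertex : ∀ {v x x′} (x∈A : x ∈ A) (x′∈A : x′ ∈ A) →
    v ≡ x ⊎ v ≡ mate x∈A → v ≡ x′ ⊎ v ≡ mate x′∈A → x ≡ x′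
  shared-vertex x∈A x′∈A (inj₁ refl) (inj₁ refl) = refl
  shared-vertex x∈A x′∈A (inj₁ refl) (inj₂ eq) = ⊥-elim (mate≢ x′∈A x∈A (sym eq))
  shared-vertex x∈A x′∈A (inj₂ eq) (inj₁ refl) = ⊥-elim (mate≢ x∈A x′∈A (sym eq))
  shared-vertex x∈A x′∈A (inj₂ eq) (inj₂ eq′) = mate-injective x∈A x′∈A (trans (sym eq) eq′)

  length≤ : Unique A → length A ≤ length B
  length≤ uA = injection⇒length≤ uA mate mate-injective mate∈B

ExactlyOneNbrWith : {V : Set} → (V → V → Set) → (V → Bool) → V → Set
ExactlyOneNbrWith {V} E P x = Σ V λ y → T (P y) × E x y × (∀ z → T (P z) → E x z → z ≡ y)

ExactlyOneNbrIn-filterᵇ : {V : Set} {E : V → V → Set} (P : V → Bool) {xs : List V} →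
  (∀ y → y ∈ xs) → ∀ {x} → ExactlyOneNbrWith E P x → ExactlyOneNbrIn E x (filterᵇ P xs)
ExactlyOneNbrIn-filterᵇ P {xs} complete (y , Py , adj , only) =
  y , ∈-filter⁺ (T? ∘ P) (complete y) Py , adj ,
  λ z z∈ → only z (proj₂ (∈-filter⁻ (T? ∘ P) {xs = xs} z∈))

matched⇒length≡ : {V : Set} (E : V → V → Set) (E-sym : ∀ {x y} → E x y → E y x) {A B : List V} →
  Unique A → Unique B → (∀ x → x ∈ A → x ∉ B) →
  (∀ x → x ∈ A → ExactlyOneNbrIn E x B) → (∀ y → y ∈ B → ExactlyOneNbrIn E y A) →
  length A ≡ length B
matched⇒length≡ E E-sym uA uB A∩B≡∅ one-in-B one-in-A = ≤-antisym
  (Matched.length≤ E E-sym A∩B≡∅ one-in-B one-in-A uA)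
  (Matched.length≤ E E-sym (λ y y∈B y∈A → A∩B≡∅ y y∈A y∈B) one-in-A one-in-B uB)

module Reduction {k m : ℕ} (G : Graph (k + m)) where
  open Construction {k} {m} G public

  eqF⇒≡ : ∀ {p} {i j : Fin p} → T (eqF i j) → i ≡ j
  eqF⇒≡ {i = i} {j} = toWitness {a? = i Fin.≟ j}

  eqF-refl : ∀ {p} (i : Fin p) → T (eqF i i)
  eqF-refl i = fromWitness {a? = i Fin.≟ i} refl

  ≢⇒¬eqF : ∀ {p} {i j : Fin p} → i ≢ j → T (not (eqF i j))
  ≢⇒¬eqF {i = i} {j} = fromWitnessFalse {a? = i Fin.≟ j}

  E′-sym : ∀ x y → E′ x y → E′ y x
  E′-sym x y = subst T (∨-comm (D x y) (D y x))

  isL isR : V′ → Bool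
  isL (vL _) = true
  isL a₁ = true
  isL a₂ = true
  isL _ = false
  isR (vR _) = true
  isR b₁ = true
  isR b₂ = true
  isR u = true
  isR _ = false

  L-clique : ∀ {x y} → isL x ≡ true → isL y ≡ true → x ≢ y → E′ x y
  L-clique {vL i} {vL j} _ _ x≢y = T-∨⁺ (inj₁ (≢⇒¬eqF (x≢y ∘ cong vL)))
  L-clique {vL _} {a₁} _ _ _ = _
  L-clique {vL _} {a₂} _ _ _ = _
  L-clique {a₁} {vL _} _ _ _ = _
  L-clique {a₁} {a₁} _ _ x≢y = ⊥-elim (x≢y refl)
  L-clique {a₁} {a₂} _ _ _ = _
  L-clique {a₂} {vL _} _ _ _ = _
  L-clique {a₂} {a₁} _ _ _ = _
  L-clique {a₂} {a₂} _ _ x≢y = ⊥-elim (x≢y refl)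

  R-clique : ∀ {x y} → isR x ≡ true → isR y ≡ true → x ≢ y → E′ x y
  R-clique {vR i} {vR j} _ _ x≢y = T-∨⁺ (inj₁ (≢⇒¬eqF (x≢y ∘ cong vR)))
  R-clique {vR _} {b₁} _ _ _ = _
  R-clique {vR _} {b₂} _ _ _ = _
  R-clique {vR _} {u} _ _ _ = _
  R-clique {b₁} {vR _} _ _ _ = _
  R-clique {b₁} {b₁} _ _ x≢y = ⊥-elim (x≢y refl)
  R-clique {b₁} {b₂} _ _ _ = _
  R-clique {b₁} {u} _ _ _ = _
  R-clique {b₂} {vR _} _ _ _ = _
  R-clique {b₂} {b₁} _ _ _ = _
  R-clique {b₂} {b₂} _ _ x≢y = ⊥-elim (x≢y refl)
  R-clique {b₂} {u} _ _ _ = _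
  R-clique {u} {vR _} _ _ _ = _
  R-clique {u} {b₁} _ _ _ = _
  R-clique {u} {b₂} _ _ _ = _
  R-clique {u} {u} _ _ x≢y = ⊥-elim (x≢y refl)

  L-neighbour : ∀ {x y} → isL y ≡ true → E′ x y → isR x ≡ false → isL x ≡ true
  L-neighbour {vL _} _ _ _ = refl
  L-neighbour {a₁} _ _ _ = refl
  L-neighbour {a₂} _ _ _ = refl
  L-neighbour {vF _} {vL _} _ ()
  L-neighbour {vF _} {a₁} _ ()
  L-neighbour {vF _} {a₂} _ ()
  L-neighbour {e _ _ _ _} {vL _} _ ()
  L-neighbour {e _ _ _ _} {a₁} _ ()
  L-neighbour {e _ _ _ _} {a₂} _ ()

  b₁-neighbour : ∀ {x} → E′ x b₁ → isR x ≡ false → x ≡ a₁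
  b₁-neighbour {a₁} _ _ = refl

  u-neighbour : ∀ {x} → E′ x u → isR x ≡ false → ∃ λ t → x ≡ vF t
  u-neighbour {vF t} _ _ = t , refl

  vF-neighbour : ∀ {x t} → E′ x (vF t) → isR x ≡ true
  vF-neighbour {vR _} _ = refl
  vF-neighbour {u} _ = refl

  -- position t : Fin 4 of a gadget is the vertex e^(t+1) of its path e¹e²e³e⁴
  isEnd isMid : Fin 4 → Bool
  isEnd t = (toℕ t ≡ᵇ 0) ∨ (toℕ t ≡ᵇ 3)
  isMid t = (toℕ t ≡ᵇ 1) ∨ (toℕ t ≡ᵇ 2)

  isEnd≡not-isMid : ∀ t → isEnd t ≡ not (isMid t)
  isEnd≡not-isMid zero = refl
  isEnd≡not-isMid (suc zero) = refl
  isEnd≡not-isMid (suc (suc zero)) = refl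
  isEnd≡not-isMid (suc (suc (suc zero))) = refl

  data Step : Fin 4 → Fin 4 → Set where
    0→1 : Step zero (suc zero)
    1→2 : Step (suc zero) (suc (suc zero))
    2→3 : Step (suc (suc zero)) (suc (suc (suc zero)))

  Adjacent : Fin 4 → Fin 4 → Set
  Adjacent t t′ = Step t t′ ⊎ Step t′ t

  stepᵇ⁻ : ∀ {t t′} → T (toℕ t′ ≡ᵇ suc (toℕ t)) → Step t t′
  stepᵇ⁻ {zero} {suc zero} _ = 0→1
  stepᵇ⁻ {suc zero} {suc (suc zero)} _ = 1→2
  stepᵇ⁻ {suc (suc zero)} {suc (suc (suc zero))} _ = 2→3

  stepᵇ⁺ : ∀ {t t′} → Step t t′ → T (toℕ t′ ≡ᵇ suc (toℕ t))
  stepᵇ⁺ 0→1 = _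
  stepᵇ⁺ 1→2 = _
  stepᵇ⁺ 2→3 = _

  adjacent-isMid : ∀ {t t′} → Adjacent t t′ → T (isMid t) ⊎ T (isMid t′)
  adjacent-isMid (inj₁ 0→1) = inj₂ _
  adjacent-isMid (inj₁ 1→2) = inj₁ _
  adjacent-isMid (inj₁ 2→3) = inj₁ _
  adjacent-isMid (inj₂ 0→1) = inj₁ _
  adjacent-isMid (inj₂ 1→2) = inj₁ _
  adjacent-isMid (inj₂ 2→3) = inj₂ _

  -- the pairs matched inside a gadget by the construction from a clique are e¹e² and e³e⁴
  partner : Fin 4 → Fin 4
  partner zero = suc zero
  partner (suc zero) = zero
  partner (suc (suc zero)) = suc (suc (suc zero))
  partner (suc (suc (suc zero))) = suc (suc zero)

  partner-adjacent : ∀ t → Adjacent t (partner t)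
  partner-adjacent zero = inj₁ 0→1
  partner-adjacent (suc zero) = inj₂ 0→1
  partner-adjacent (suc (suc zero)) = inj₁ 2→3
  partner-adjacent (suc (suc (suc zero))) = inj₂ 2→3

  isMid-partner : ∀ t → isMid (partner t) ≡ not (isMid t)
  isMid-partner zero = refl
  isMid-partner (suc zero) = refl
  isMid-partner (suc (suc zero)) = refl
  isMid-partner (suc (suc (suc zero))) = refl

  adjacent-unlike⇒partner : ∀ {t t′} → Adjacent t t′ → isMid t ≢ isMid t′ → t′ ≡ partner t
  adjacent-unlike⇒partner (inj₁ 0→1) _ = refl
  adjacent-unlike⇒partner (inj₁ 1→2) unlike = ⊥-elim (unlike refl)
  adjacent-unlike⇒partner (inj₁ 2→3) _ = refl
  adjacent-unlike⇒partner (inj₂ 0→1) _ = refl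
  adjacent-unlike⇒partner (inj₂ 1→2) unlike = ⊥-elim (unlike refl)
  adjacent-unlike⇒partner (inj₂ 2→3) _ = refl

  e-step⁻ : ∀ {t t′ i i′ j j′ p p′} → T (D (e t i j p) (e t′ i′ j′ p′)) →
    i ≡ i′ × j ≡ j′ × Step t t′
  e-step⁻ d with T-∧⁻ d
  ... | i≡ , d′ with T-∧⁻ d′
  ...   | j≡ , step = eqF⇒≡ i≡ , eqF⇒≡ j≡ , stepᵇ⁻ step

  e-adj⁻ : ∀ {t t′ i i′ j j′ p p′} → E′ (e t i j p) (e t′ i′ j′ p′) →
    i ≡ i′ × j ≡ j′ × Adjacent t t′
  e-adj⁻ {t} {t′} {i} {i′} {j} {j′} {p} {p′} adj with T-∨⁻ adj
  ... | inj₁ d with e-step⁻ {t} {t′} {i} {i′} {j} {j′} {p} {p′} d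
  ...   | i≡ , j≡ , step = i≡ , j≡ , inj₁ step
  e-adj⁻ {t} {t′} {i} {i′} {j} {j′} {p} {p′} adj | inj₂ d
    with e-step⁻ {t′} {t} {i′} {i} {j′} {j} {p′} {p} d
  ...   | i≡ , j≡ , step = sym i≡ , sym j≡ , inj₂ step

  e-adj⁺ : ∀ {t t′ i j p p′} → Adjacent t t′ → E′ (e t i j p) (e t′ i j p′)
  e-adj⁺ {i = i} {j} (inj₁ step) = T-∨⁺ (inj₁ (T-∧⁺ (eqF-refl i) (T-∧⁺ (eqF-refl j) (stepᵇ⁺ step))))
  e-adj⁺ {i = i} {j} (inj₂ step) = T-∨⁺ (inj₂ (T-∧⁺ (eqF-refl i) (T-∧⁺ (eqF-refl j) (stepᵇ⁺ step))))

  vR-e-adj⁻ : ∀ {r t i j p} → E′ (vR r) (e t i j p) → (r ≡ i × T (isEnd t)) ⊎ (r ≡ j × T (isMid t))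
  vR-e-adj⁻ adj with T-∨⁻ (T-∨-false⁻ adj)
  ... | inj₁ end = inj₁ (eqF⇒≡ (proj₁ (T-∧⁻ end)) , proj₂ (T-∧⁻ end))
  ... | inj₂ mid = inj₂ (eqF⇒≡ (proj₁ (T-∧⁻ mid)) , proj₂ (T-∧⁻ mid))

  end-adj : ∀ {t i j p} → T (isEnd t) → E′ (e t i j p) (vR i)
  end-adj {i = i} end = T-∨⁺ (inj₁ (T-∧⁺ (eqF-refl i) end))

  mid-adj : ∀ {t i j p} → T (isMid t) → E′ (e t i j p) (vR j)
  mid-adj {j = j} mid = T-∨⁺ (inj₂ (T-∧⁺ (eqF-refl j) mid))

  touches-vR : ∀ t {i j p} → E′ (e t i j p) (vR i) ⊎ E′ (e t i j p) (vR j)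
  touches-vR zero {i} {j} {p} = inj₁ (end-adj {zero} {i} {j} {p} _)
  touches-vR (suc zero) {i} {j} {p} = inj₂ (mid-adj {suc zero} {i} {j} {p} _)
  touches-vR (suc (suc zero)) {i} {j} {p} = inj₂ (mid-adj {suc (suc zero)} {i} {j} {p} _)
  touches-vR (suc (suc (suc zero))) {i} {j} {p} = inj₁ (end-adj {suc (suc (suc zero))} {i} {j} {p} _)

  e-neighbour : ∀ {x t′ i j p′} → E′ x (e t′ i j p′) → isR x ≡ false → ∃₂ λ t p → x ≡ e t i j p
  e-neighbour {e t i j p} {t′} {i′} {j′} {p′} adj _
    with e-adj⁻ {t} {t′} {i} {i′} {j} {j′} {p} {p′} adj
  ... | refl , refl , _ = t , p , refl

  overNonEdges : {X : Set} → ((i j : Fin k) → T (nonEdge i j) → List X) → List X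
  overNonEdges g = concatMap (λ i → concatMap (λ j → ifT (nonEdge i j) (g i j)) (allFin k)) (allFin k)

  module _ {X : Set} (g : (i j : Fin k) → T (nonEdge i j) → List X) where

    private
      row : Fin k → List X
      row i = concatMap (λ j → ifT (nonEdge i j) (g i j)) (allFin k)

      ∈-row⁻ : ∀ {x i} → x ∈ row i → ∃ λ j → Σ (T (nonEdge i j)) λ q → x ∈ g i j q
      ∈-row⁻ {i = i} x∈ with Any.satisfied (∈-concatMap⁻ _ {xs = allFin k} x∈)
      ... | j , x∈cell = j , ∈-ifT⁻ (nonEdge i j) x∈cell

    ∈-overNonEdges⁺ : ∀ {x i j} (q : T (nonEdge i j)) → x ∈ g i j q → x ∈ overNonEdges g
    ∈-overNonEdges⁺ {i = i} {j} q x∈ = ∈-concatMap⁺ _ (Any.map (λ { refl → ∈-concatMap⁺ _ (Any.map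
      (λ { refl → ∈-ifT⁺ (nonEdge i j) q x∈ }) (∈-allFin j)) }) (∈-allFin i))

    ∈-overNonEdges⁻ : ∀ {x} → x ∈ overNonEdges g →
      ∃₂ λ i j → Σ (T (nonEdge i j)) λ q → x ∈ g i j q
    ∈-overNonEdges⁻ x∈ with Any.satisfied (∈-concatMap⁻ _ {xs = allFin k} x∈)
    ... | i , x∈row = i , ∈-row⁻ x∈row

    Unique-overNonEdges : (∀ i j q → Unique (g i j q)) →
      (∀ {x i j i′ j′ q q′} → x ∈ g i j q → x ∈ g i′ j′ q′ → i ≡ i′ × j ≡ j′) →
      Unique (overNonEdges g)
    Unique-overNonEdges ug index = Unique-concatMap row (UP.allFin⁺ k) (All.universal Unique-row _)
      λ x∈ x∈′ → proj₁ (index (proj₂ (proj₂ (∈-row⁻ x∈))) (proj₂ (proj₂ (∈-row⁻ x∈′))))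
      where
      Unique-row : ∀ i → Unique (row i)
      Unique-row i = Unique-concatMap _ (UP.allFin⁺ k)
        (All.universal (λ j → Unique-ifT (nonEdge i j) (ug i j)) _)
        λ {j} {j′} x∈ x∈′ →
          proj₂ (index (proj₂ (∈-ifT⁻ (nonEdge i j) x∈)) (proj₂ (∈-ifT⁻ (nonEdge i j′) x∈′)))

    length-filterᵇ-overNonEdges : (P : X → Bool) (c : ℕ) →
      (∀ i j q → length (filterᵇ P (g i j q)) ≡ c) →
      length (filterᵇ P (overNonEdges g)) ≡ c * nonEdgeCount
    length-filterᵇ-overNonEdges P c per-gadget = begin
      length (filterᵇ P (overNonEdges g))                      ≡⟨ length-filterᵇ-concatMap P row (allFin k) ⟩
      sum (map (λ i → length (filterᵇ P (row i))) (allFin k))  ≡⟨ cong sum (map-cong row-count (allFin k)) ⟩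
      sum (map (λ i → c * sum (map (indicator i) (allFin k))) (allFin k))
                                                               ≡⟨ sum-map-*ˡ c _ (allFin k) ⟩
      c * nonEdgeCount                                         ∎
      where
      open ≡-Reasoning
      indicator : Fin k → Fin k → ℕ
      indicator i j = if nonEdge i j then 1 else 0

      cell : ∀ b {xs : T b → List X} → (∀ q → length (filterᵇ P (xs q)) ≡ c) →
        length (filterᵇ P (ifT b xs)) ≡ c * (if b then 1 else 0)
      cell true per = trans (per _) (sym (*-identityʳ c))
      cell false _ = sym (*-zeroʳ c)

      row-count : ∀ i → length (filterᵇ P (row i)) ≡ c * sum (map (indicator i) (allFin k))
      row-count i = trans (length-filterᵇ-concatMap P _ (allFin k)) (trans
        (cong sum (map-cong (λ j → cell (nonEdge i j) (per-gadget i j)) (allFin k)))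
        (sum-map-*ˡ c _ (allFin k)))

  gadget : (i j : Fin k) → T (nonEdge i j) → List V′
  gadget i j q = map (λ t → e t i j q) (allFin 4)

  gadgetVertices : List V′
  gadgetVertices = overNonEdges gadget

  ∈-gadgetVertices : ∀ t i j q → e t i j q ∈ gadgetVertices
  ∈-gadgetVertices t i j q = ∈-overNonEdges⁺ gadget q (∈-map⁺ (λ t → e t i j q) (∈-allFin t))

  ∈-gadgetVertices⁻ : ∀ {x} → x ∈ gadgetVertices → ∃₂ λ t i → ∃₂ λ j q → x ≡ e t i j q
  ∈-gadgetVertices⁻ x∈ with ∈-overNonEdges⁻ gadget x∈
  ... | i , j , q , x∈gadget with ∈-map⁻ (λ t → e t i j q) x∈gadget
  ...   | t , _ , x≡ = t , i , j , q , x≡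

  Unique-gadgetVertices : Unique gadgetVertices
  Unique-gadgetVertices = Unique-overNonEdges gadget
    (λ i j q → UP.map⁺ {f = λ t → e t i j q} (λ { refl → refl }) (UP.allFin⁺ 4)) index
    where
    index : ∀ {x i j i′ j′ q q′} → x ∈ gadget i j q → x ∈ gadget i′ j′ q′ →
      i ≡ i′ × j ≡ j′
    index {i = i} {j} {i′} {j′} {q} {q′} x∈ x∈′
      with ∈-map⁻ (λ t → e t i j q) x∈ | ∈-map⁻ (λ t → e t i′ j′ q′) x∈′
    ... | _ , _ , refl | _ , _ , refl = refl , refl

  isMidᵛ : V′ → Bool
  isMidᵛ (e t _ _ _) = isMid t
  isMidᵛ _ = false

  e-irrelevant : ∀ {t i j q q′} → e t i j q ≡ e t i j q′
  e-irrelevant {t} {i} {j} {q} {q′} = cong (e t i j) (T-irrelevant q q′)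

  code : V′ → List ℕ
  code (vL i) = 0 ∷ toℕ i ∷ []
  code a₁ = 1 ∷ []
  code a₂ = 2 ∷ []
  code (vR i) = 3 ∷ toℕ i ∷ []
  code b₁ = 4 ∷ []
  code b₂ = 5 ∷ []
  code u = 6 ∷ []
  code (vF t) = 7 ∷ toℕ t ∷ []
  code (e t i j _) = 8 ∷ toℕ t ∷ toℕ i ∷ toℕ j ∷ []

  code-injective : ∀ {x y} → code x ≡ code y → x ≡ y
  code-injective {vL _} {vL _} eq = cong vL (toℕ-injective (∷-injectiveˡ (∷-injectiveʳ eq)))
  code-injective {a₁} {a₁} _ = refl
  code-injective {a₂} {a₂} _ = refl
  code-injective {vR _} {vR _} eq = cong vR (toℕ-injective (∷-injectiveˡ (∷-injectiveʳ eq)))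
  code-injective {b₁} {b₁} _ = refl
  code-injective {b₂} {b₂} _ = refl
  code-injective {u} {u} _ = refl
  code-injective {vF _} {vF _} eq = cong vF (toℕ-injective (∷-injectiveˡ (∷-injectiveʳ eq)))
  code-injective {e t i j q} {e t′ i′ j′ q′} eq
    with toℕ-injective (∷-injectiveˡ (∷-injectiveʳ eq))
       | toℕ-injective (∷-injectiveˡ (∷-injectiveʳ (∷-injectiveʳ eq)))
       | toℕ-injective (∷-injectiveˡ (∷-injectiveʳ (∷-injectiveʳ (∷-injectiveʳ eq))))
  ... | refl | refl | refl = e-irrelevant

  _≟_ : DecidableEquality V′
  x ≟ y = map′ code-injective (cong code) (≡-dec ℕ._≟_ (code x) (code y))

  kind : V′ → Fin 9
  kind (vL _) = # 0
  kind a₁ = # 1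
  kind a₂ = # 2
  kind (vR _) = # 3
  kind b₁ = # 4
  kind b₂ = # 5
  kind u = # 6
  kind (vF _) = # 7
  kind (e _ _ _ _) = # 8

  ofKind : ℕ → List V′
  ofKind 0 = map vL (allFin k)
  ofKind 1 = a₁ ∷ []
  ofKind 2 = a₂ ∷ []
  ofKind 3 = map vR (allFin k)
  ofKind 4 = b₁ ∷ []
  ofKind 5 = b₂ ∷ []
  ofKind 6 = u ∷ []
  ofKind 7 = map vF (allFin m)
  ofKind 8 = gadgetVertices
  ofKind _ = []

  ofKind-kind : ∀ {x} n → x ∈ ofKind n → toℕ (kind x) ≡ n
  ofKind-kind 0 x∈ with ∈-map⁻ vL x∈
  ... | _ , _ , refl = refl
  ofKind-kind 1 (here refl) = refl
  ofKind-kind 2 (here refl) = refl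
  ofKind-kind 3 x∈ with ∈-map⁻ vR x∈
  ... | _ , _ , refl = refl
  ofKind-kind 4 (here refl) = refl
  ofKind-kind 5 (here refl) = refl
  ofKind-kind 6 (here refl) = refl
  ofKind-kind 7 x∈ with ∈-map⁻ vF x∈
  ... | _ , _ , refl = refl
  ofKind-kind 8 x∈ = gadget-kind (proj₂ (proj₂ (proj₂ (proj₂ (∈-gadgetVertices⁻ x∈)))))
    where
    gadget-kind : ∀ {x t i j q} → x ≡ e t i j q → toℕ (kind x) ≡ 8
    gadget-kind refl = refl

  ∈-ofKind : ∀ x → x ∈ ofKind (toℕ (kind x))
  ∈-ofKind (vL i) = ∈-map⁺ vL (∈-allFin i)
  ∈-ofKind a₁ = here refl
  ∈-ofKind a₂ = here refl
  ∈-ofKind (vR i) = ∈-map⁺ vR (∈-allFin i)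
  ∈-ofKind b₁ = here refl
  ∈-ofKind b₂ = here refl
  ∈-ofKind u = here refl
  ∈-ofKind (vF t) = ∈-map⁺ vF (∈-allFin t)
  ∈-ofKind (e t i j q) = ∈-gadgetVertices t i j q

  vertices : List V′
  vertices = concatMap ofKind (upTo 9)

  ∈-vertices : ∀ x → x ∈ vertices
  ∈-vertices x = ∈-concatMap⁺ ofKind (Any.map (λ { refl → ∈-ofKind x }) (∈-upTo⁺ (toℕ<n (kind x))))

  Unique-vertices : Unique vertices
  Unique-vertices = Unique-concatMap ofKind (UP.upTo⁺ 9)
    (UP.map⁺ (λ { refl → refl }) (UP.allFin⁺ k) ∷ singleton ∷ singleton ∷
     UP.map⁺ (λ { refl → refl }) (UP.allFin⁺ k) ∷ singleton ∷ singleton ∷ singleton ∷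
     UP.map⁺ (λ { refl → refl }) (UP.allFin⁺ m) ∷ Unique-gadgetVertices ∷ [])
    (λ {n} {n′} x∈ x∈′ → trans (sym (ofKind-kind n x∈)) (ofKind-kind n′ x∈′))
    where
    singleton : ∀ {x : V′} → Unique (x ∷ [])
    singleton = [] ∷ []

-- From a clique of G to perfectly matched sets of G′

module FromClique {k m : ℕ} (G : Graph (k + m)) (cover : FirstIsVertexCover {k} {m} G) {l : ℕ}
  (f : Fin l → Fin (k + m)) (f-injective : Injective _≡_ _≡_ f)
  (f-clique : ∀ a b → a ≢ b → T (adj G (f a) (f b))) where

  open Reduction {k} {m} G

  Member : Fin (k + m) → Set
  Member v = ∃ λ a → f a ≡ v

  inC : Fin k → Bool
  inC i = ⌊ any? (λ a → f a Fin.≟ i ↑ˡ m) ⌋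

  inF : Fin m → Bool
  inF t = ⌊ any? (λ a → f a Fin.≟ k ↑ʳ t) ⌋

  members-adjacent : ∀ {v w} → Member v → Member w → v ≢ w → T (adj G v w)
  members-adjacent (a , refl) (b , refl) v≢w = f-clique a b (v≢w ∘ cong f)

  inC-adjacent : ∀ {i j} → T (inC i) → T (inC j) → i ≢ j → T (adjC i j)
  inC-adjacent i∈ j∈ i≢j = members-adjacent (toWitness i∈) (toWitness j∈) (i≢j ∘ ↑ˡ-injective m _ _)

  inF-adjacent : ∀ {t i} → T (inF t) → T (inC i) → T (adj G (k ↑ʳ t) (i ↑ˡ m))
  inF-adjacent {t} {i} t∈ i∈ = members-adjacent (toWitness t∈) (toWitness i∈) (↑ˡ≢↑ʳ i t ∘ sym)

  -- two clique vertices outside the vertex cover would span an uncovered edge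
  inF-unique : ∀ {t t′} → T (inF t) → T (inF t′) → t ≡ t′
  inF-unique {t} {t′} t∈ t′∈ with t Fin.≟ t′
  ... | yes t≡t′ = t≡t′
  ... | no t≢t′
    with cover _ _ (members-adjacent (toWitness t∈) (toWitness t′∈) (t≢t′ ∘ ↑ʳ-injective k t t′))
  ...   | inj₁ lt = ⊥-elim (toℕ-↑ʳ≮ k t lt)
  ...   | inj₂ lt = ⊥-elim (toℕ-↑ʳ≮ k t′ lt)

  nonEdge-not-inC² : ∀ {i j} → T (inC i) → T (inC j) → T (nonEdge i j) → ⊥
  nonEdge-not-inC² {i} {j} i∈ j∈ ne with T-∧⁻ ne
  ... | i<j , ¬adj =
    T-not (inC-adjacent i∈ j∈ (λ { refl → <-irrefl refl (<ᵇ⇒< (toℕ i) (toℕ j) i<j) })) ¬adj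

  anyF : Bool
  anyF = ⌊ any? (T? ∘ inF) ⌋

  onA : Bool → Fin 4 → Bool
  onA c t = if c then isMid t else not (isMid t)

  inA inB : V′ → Bool
  inA (vL i) = inC i
  inA a₁ = true
  inA a₂ = true
  inA (vF t) = inF t
  inA (e t i _ _) = onA (inC i) t
  inA _ = false
  inB (vR i) = inC i
  inB b₁ = true
  inB b₂ = true
  inB u = anyF
  inB (e t i _ _) = onA (not (inC i)) t
  inB _ = false

  onA-exclusive : ∀ c t → T (onA c t) → T (onA (not c) t) → ⊥
  onA-exclusive true t mid end = T-not mid end
  onA-exclusive false t end mid = T-not mid end

  sides-unlike : ∀ c {t t′} → T (onA c t) → T (onA (not c) t′) → isMid t ≢ isMid t′
  sides-unlike c {t′ = t′} onA-t onB-t′ eq =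
    onA-exclusive c t′ (subst (λ b → T (if c then b else not b)) eq onA-t) onB-t′

  mid-side : ∀ c t → T (onA c t) → T (isMid t) → T c
  mid-side true t _ _ = _
  mid-side false t end mid = ⊥-elim (T-not mid end)

  end-side : ∀ c t → T (onA c t) → T (isEnd t) → T (not c)
  end-side true t mid end = ⊥-elim (T-not mid (subst T (isEnd≡not-isMid t) end))
  end-side false t _ _ = _

  onA-partner : ∀ c t → T (onA c t) → T (onA (not c) (partner t))
  onA-partner c t side rewrite isMid-partner t with c | isMid t
  ... | true  | true  = _
  ... | false | false = _

  onB-partner : ∀ c t → T (onA (not c) t) → T (onA c (partner t))
  onB-partner c t side rewrite isMid-partner t with c | isMid t
  ... | true  | false = _
  ... | false | true  = _

  vR-gadget-unmatched : ∀ {r t i j q} → T (inC r) → T (onA (inC i) t) → E′ (vR r) (e t i j q) → ⊥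
  vR-gadget-unmatched {r} {t} {i} {j} {q} r∈ side adj with vR-e-adj⁻ {r} {t} {i} {j} {q} adj
  ... | inj₁ (refl , end) = T-not r∈ (end-side (inC i) t side end)
  ... | inj₂ (refl , mid) = nonEdge-not-inC² (mid-side (inC i) t side mid) r∈ q

  mateA : ∀ x → T (inA x) → ExactlyOneNbrWith E′ inB x
  mateA (vL i) i∈ = vR i , i∈ , T-∨⁺ (inj₁ (eqF-refl i)) , only
    where
    only : ∀ z → T (inB z) → E′ (vL i) z → z ≡ vR i
    only (vR j) _ adj = cong vR (sym (eqF⇒≡ (T-∨-false⁻ adj)))
  mateA a₁ _ = b₁ , _ , _ , only
    where
    only : ∀ z → T (inB z) → E′ a₁ z → z ≡ b₁
    only b₁ _ _ = refl
  mateA a₂ _ = b₂ , _ , _ , only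
    where
    only : ∀ z → T (inB z) → E′ a₂ z → z ≡ b₂
    only b₂ _ _ = refl
  mateA (vF t) t∈ = u , fromWitness (t , t∈) , _ , only
    where
    only : ∀ z → T (inB z) → E′ (vF t) z → z ≡ u
    only (vR j) j∈ adj = ⊥-elim (T-not (inF-adjacent t∈ j∈) (T-∨-false⁻ adj))
    only u _ _ = refl
  mateA (e t i j q) side =
    e (partner t) i j q , onA-partner (inC i) t side , e-adj⁺ {t} {partner t} {i} {j} {q} {q} (partner-adjacent t) ,
    only
    where
    only : ∀ z → T (inB z) → E′ (e t i j q) z → z ≡ e (partner t) i j q
    only (vR r) r∈ adj =
      ⊥-elim (vR-gadget-unmatched {r} {t} {i} {j} {q} r∈ side (E′-sym (e t i j q) (vR r) adj))
    only (e t′ i′ j′ q′) side′ adj with e-adj⁻ {t} {t′} {i} {i′} {j} {j′} {q} {q′} adj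
    ... | refl , refl , steps = trans
      (cong (λ s → e s i j q′) (adjacent-unlike⇒partner steps (sides-unlike (inC i) {t} {t′} side side′)))
      e-irrelevant

  mateB : ∀ y → T (inB y) → ExactlyOneNbrWith E′ inA y
  mateB (vR i) i∈ = vL i , i∈ , eqF-refl i , only
    where
    only : ∀ z → T (inA z) → E′ (vR i) z → z ≡ vL i
    only (vL j) _ adj = cong vL (eqF⇒≡ adj)
    only (vF t) t∈ adj = ⊥-elim (T-not (inF-adjacent t∈ i∈) adj)
    only (e t i′ j q) side adj = ⊥-elim (vR-gadget-unmatched {i} {t} {i′} {j} {q} i∈ side adj)
  mateB b₁ _ = a₁ , _ , _ , only
    where
    only : ∀ z → T (inA z) → E′ b₁ z → z ≡ a₁
    only a₁ _ _ = refl
  mateB b₂ _ = a₂ , _ , _ , only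
    where
    only : ∀ z → T (inA z) → E′ b₂ z → z ≡ a₂
    only a₂ _ _ = refl
  mateB u some-t∈ with toWitness some-t∈
  ... | t , t∈ = vF t , t∈ , _ , only
    where
    only : ∀ z → T (inA z) → E′ u z → z ≡ vF t
    only (vF t′) t′∈ _ = cong vF (inF-unique t′∈ t∈)
  mateB (e t i j q) side =
    e (partner t) i j q , onB-partner (inC i) t side , e-adj⁺ {t} {partner t} {i} {j} {q} {q} (partner-adjacent t) ,
    only
    where
    only : ∀ z → T (inA z) → E′ (e t i j q) z → z ≡ e (partner t) i j q
    only (e t′ i′ j′ q′) side′ adj with e-adj⁻ {t} {t′} {i} {i′} {j} {j′} {q} {q′} adj
    ... | refl , refl , steps = trans
      (cong (λ s → e s i j q′) (adjacent-unlike⇒partner steps (sides-unlike (inC i) {t′} {t} side′ side ∘ sym)))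
      e-irrelevant

  A∩B≡∅ : ∀ x → T (inA x) → T (inB x) → ⊥
  A∩B≡∅ (e t i _ _) = onA-exclusive (inC i) t

  A B : List V′
  A = filterᵇ inA vertices
  B = filterᵇ inB vertices

  Cs : List (Fin k)
  Cs = filterᵇ inC (allFin k)

  Fs : List (Fin m)
  Fs = filterᵇ inF (allFin m)

  ∈members⇒Member : ∀ {v} → v ∈ combine Cs Fs → Member v
  ∈members⇒Member v∈ with ∈-combine⁻ {k} {m} {Cs} {Fs} v∈
  ... | inj₁ (i , i∈ , refl) = toWitness (proj₂ (∈-filter⁻ (T? ∘ inC) {xs = allFin k} i∈))
  ... | inj₂ (t , t∈ , refl) = toWitness (proj₂ (∈-filter⁻ (T? ∘ inF) {xs = allFin m} t∈))

  Member⇒∈members : ∀ {v} → Member v → v ∈ combine Cs Fs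
  Member⇒∈members {v} member with splitAt k v in eq
  ... | inj₁ i = subst (_∈ combine Cs Fs) (splitAt⁻¹-↑ˡ eq) (∈-++⁺ˡ (∈-map⁺ (_↑ˡ m)
    (∈-filter⁺ (T? ∘ inC) (∈-allFin i) (fromWitness (subst Member (sym (splitAt⁻¹-↑ˡ eq)) member)))))
  ... | inj₂ t = subst (_∈ combine Cs Fs) (splitAt⁻¹-↑ʳ eq) (∈-++⁺ʳ (map (_↑ˡ m) Cs) (∈-map⁺ (k ↑ʳ_)
    (∈-filter⁺ (T? ∘ inF) (∈-allFin t) (fromWitness (subst Member (sym (splitAt⁻¹-↑ʳ eq)) member)))))

  clique-size : length Cs + length Fs ≡ l
  clique-size = begin
    length Cs + length Fs      ≡⟨ length-combine Cs Fs ⟨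
    length (combine Cs Fs)     ≡⟨ ⊇⊆⇒length≡
                                    (Unique-combine (UP.filter⁺ (T? ∘ inC) (UP.allFin⁺ k))
                                                    (UP.filter⁺ (T? ∘ inF) (UP.allFin⁺ m)))
                                    (UP.tabulate⁺ f-injective)
                                    (λ v∈ → let a , fa≡v = ∈members⇒Member v∈ in
                                            subst (_∈ tabulate f) fa≡v (∈-tabulate⁺ a))
                                    (λ v∈ → let a , v≡fa = ∈-tabulate⁻ v∈ in Member⇒∈members (a , sym v≡fa)) ⟩
    length (tabulate f)        ≡⟨ length-tabulate f ⟩
    l                          ∎
    where open ≡-Reasoning

  two-per-gadget : ∀ c → length (filterᵇ (onA c) (allFin 4)) ≡ 2
  two-per-gadget true = refl
  two-per-gadget false = refl

  length-A : length A ≡ 2 + 2 * nonEdgeCount + l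
  length-A = begin
    length A
      ≡⟨ length-filterᵇ-concatMap inA ofKind (upTo 9) ⟩
    length (filterᵇ inA (map vL (allFin k))) + (2 + (length (filterᵇ inA (map vR (allFin k))) +
      (length (filterᵇ inA (map vF (allFin m))) + (length (filterᵇ inA gadgetVertices) + 0))))
      ≡⟨ cong₂ (λ c rest → c + (2 + rest)) on-vL (cong₂ _+_ on-vR (cong₂ (λ f g → f + (g + 0)) on-vF on-gadgets)) ⟩
    length Cs + (2 + (0 + (length Fs + (2 * nonEdgeCount + 0))))
      ≡⟨ rearrange (length Cs) (length Fs) (2 * nonEdgeCount) ⟩
    2 + 2 * nonEdgeCount + (length Cs + length Fs)
      ≡⟨ cong (2 + 2 * nonEdgeCount +_) clique-size ⟩
    2 + 2 * nonEdgeCount + l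
      ∎
    where
    open ≡-Reasoning
    on-vL : length (filterᵇ inA (map vL (allFin k))) ≡ length Cs
    on-vL = length-filterᵇ-map inA vL (allFin k)
    on-vR : length (filterᵇ inA (map vR (allFin k))) ≡ 0
    on-vR = trans (length-filterᵇ-map inA vR (allFin k)) (length-filterᵇ-false (allFin k))
    on-vF : length (filterᵇ inA (map vF (allFin m))) ≡ length Fs
    on-vF = length-filterᵇ-map inA vF (allFin m)
    on-gadgets : length (filterᵇ inA gadgetVertices) ≡ 2 * nonEdgeCount
    on-gadgets = length-filterᵇ-overNonEdges gadget inA 2 λ i j q →
      trans (length-filterᵇ-map inA (λ t → e t i j q) (allFin 4)) (two-per-gadget (inC i))
    rearrange : ∀ c f n → c + (2 + (0 + (f + (n + 0)))) ≡ 2 + n + (c + f)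
    rearrange = solve-∀

  Unique-A : Unique A
  Unique-A = UP.filter⁺ (T? ∘ inA) Unique-vertices

  Unique-B : Unique B
  Unique-B = UP.filter⁺ (T? ∘ inB) Unique-vertices

  A-disjoint-B : ∀ x → x ∈ A → x ∉ B
  A-disjoint-B x x∈A x∈B = A∩B≡∅ x (proj₂ (∈-filter⁻ (T? ∘ inA) {xs = vertices} x∈A))
    (proj₂ (∈-filter⁻ (T? ∘ inB) {xs = vertices} x∈B))

  one-in-B : ∀ x → x ∈ A → ExactlyOneNbrIn E′ x B
  one-in-B x x∈ =
    ExactlyOneNbrIn-filterᵇ {E = E′} inB ∈-vertices (mateA x (proj₂ (∈-filter⁻ (T? ∘ inA) {xs = vertices} x∈)))

  one-in-A : ∀ y → y ∈ B → ExactlyOneNbrIn E′ y A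
  one-in-A y y∈ =
    ExactlyOneNbrIn-filterᵇ {E = E′} inA ∈-vertices (mateB y (proj₂ (∈-filter⁻ (T? ∘ inB) {xs = vertices} y∈)))

  length-B : length B ≡ 2 + 2 * nonEdgeCount + l
  length-B = trans
    (sym (matched⇒length≡ E′ (λ {x} {y} → E′-sym x y) Unique-A Unique-B A-disjoint-B one-in-B one-in-A))
    length-A

  hasPMS : HasPMS E′ (2 + 2 * nonEdgeCount + l)
  hasPMS = A , B , Unique-A , Unique-B , length-A , length-B , A-disjoint-B , one-in-B , one-in-A

-- From perfectly matched sets of G′ to a clique of G

module ToClique {k m : ℕ} (G : Graph (k + m)) where

  open Reduction {k} {m} G
  open import Data.List.Membership.DecPropositional _≟_ using (_∈?_)

  module Charging {A B : List V′} (Unique-A : Unique A) (A∩B≡∅ : ∀ x → x ∈ A → x ∉ B)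
    (one-in-B : ∀ x → x ∈ A → ExactlyOneNbrIn E′ x B)
    (one-in-A : ∀ y → y ∈ B → ExactlyOneNbrIn E′ y A)
    (oriented : (∀ x → x ∈ A → isR x ≡ false) ⊎ (∃ λ y → y ∈ B × isR y ≡ true)) where

    open Matched E′ (λ {x} {y} → E′-sym x y) A∩B≡∅ one-in-B one-in-A

    R-mate : ∀ {x} (x∈A : x ∈ A) → isR x ≡ true → isR (mate x∈A) ≡ true
    R-mate {x} x∈A Rx = from oriented
      where
      from : (∀ x → x ∈ A → isR x ≡ false) ⊎ (∃ λ y → y ∈ B × isR y ≡ true) → isR (mate x∈A) ≡ true
      from (inj₁ A∩R≡∅) with () ← trans (sym Rx) (A∩R≡∅ x x∈A)
      from (inj₂ (y , y∈B , Ry)) =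
        subst (λ z → isR z ≡ true) (mate-unique x∈A y∈B (R-clique Rx Ry λ { refl → A∩B≡∅ x x∈A y∈B })) Ry

    Conflict : Fin k → Fin k → Set
    Conflict i j = T (nonEdge j i) × vR j ∈ B

    conflict? : ∀ i → Dec (∃ (Conflict i))
    conflict? i = any? (λ j → T? (nonEdge j i) ×-dec (vR j ∈? B))

    InK : Fin k → Set
    InK i = vR i ∈ B × ¬ ∃ (Conflict i)

    inK? : ∀ i → Dec (InK i)
    inK? i = (vR i ∈? B) ×-dec ¬? (conflict? i)

    InF : Fin m → Set
    InF t = vF t ∈ A × u ∈ B

    inF? : ∀ t → Dec (InF t)
    inF? t = (vF t ∈? A) ×-dec (u ∈? B)

    Ks : List (Fin k)
    Ks = filter inK? (allFin k)

    Fs : List (Fin m)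
    Fs = filter inF? (allFin m)

    clique : List (Fin (k + m))
    clique = combine Ks Fs

    InK-adjacent< : ∀ {i j} → InK i → InK j → toℕ j < toℕ i → T (adjC j i)
    InK-adjacent< {i} {j} (_ , no-conflict) (j∈B , _) j<i with T? (adjC j i)
    ... | yes adj = adj
    ... | no ¬adj = ⊥-elim (no-conflict (j , T-∧⁺ (<⇒<ᵇ j<i) (¬T⇒T-not ¬adj) , j∈B))

    InK-adjacent : ∀ {i j} → i ≢ j → InK i → InK j → T (adjC i j)
    InK-adjacent {i} {j} i≢j Ki Kj with <-cmp (toℕ i) (toℕ j)
    ... | tri< i<j _ _ = InK-adjacent< Kj Ki i<j
    ... | tri≈ _ i≡j _ = ⊥-elim (i≢j (toℕ-injective i≡j))
    ... | tri> _ _ j<i = subst T (adj-sym G _ _) (InK-adjacent< Ki Kj j<i)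

    -- u ∈ B has only one neighbour in A
    InF-unique : ∀ {t t′} → InF t → InF t′ → t ≡ t′
    InF-unique (t∈A , u∈B) (t′∈A , _) with one-in-A u u∈B
    ... | _ , _ , _ , only with only _ t∈A _ | only _ t′∈A _
    ...   | refl | refl = refl

    -- otherwise v″_j ∈ B would be a second neighbour of v′_{k+t} besides u
    InF-adjacent : ∀ {t j} → InF t → InK j → T (adj G (k ↑ʳ t) (j ↑ˡ m))
    InF-adjacent {t} {j} (t∈A , u∈B) (j∈B , _) with T? (adj G (k ↑ʳ t) (j ↑ˡ m))
    ... | yes adj = adj
    ... | no ¬adj
      with () ← trans (mate-unique t∈A j∈B (T-∨⁺ (inj₁ (¬T⇒T-not ¬adj)))) (sym (mate-unique t∈A u∈B _))

    clique-IsClique : IsCliqueList G clique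
    clique-IsClique =
      Unique-combine (UP.filter⁺ inK? (UP.allFin⁺ k)) (UP.filter⁺ inF? (UP.allFin⁺ m)) , adjacent
      where
      K∈ : ∀ {i} → i ∈ Ks → InK i
      K∈ i∈ = proj₂ (∈-filter⁻ inK? {xs = allFin k} i∈)
      F∈ : ∀ {t} → t ∈ Fs → InF t
      F∈ t∈ = proj₂ (∈-filter⁻ inF? {xs = allFin m} t∈)
      adjacent : ∀ {a b} → a ∈ clique → b ∈ clique → a ≢ b → T (adj G a b)
      adjacent a∈ b∈ a≢b with ∈-combine⁻ {is = Ks} {Fs} a∈ | ∈-combine⁻ {is = Ks} {Fs} b∈
      ... | inj₁ (i , i∈ , refl) | inj₁ (j , j∈ , refl) =
        InK-adjacent (a≢b ∘ cong (_↑ˡ m)) (K∈ i∈) (K∈ j∈)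
      ... | inj₁ (i , i∈ , refl) | inj₂ (t , t∈ , refl) =
        subst T (adj-sym G _ _) (InF-adjacent (F∈ t∈) (K∈ i∈))
      ... | inj₂ (t , t∈ , refl) | inj₁ (j , j∈ , refl) =
        InF-adjacent (F∈ t∈) (K∈ j∈)
      ... | inj₂ (t , t∈ , refl) | inj₂ (t′ , t′∈ , refl) =
        ⊥-elim (a≢b (cong (k ↑ʳ_) (InF-unique (F∈ t∈) (F∈ t′∈))))

    references : List V′
    references = a₁ ∷ a₂ ∷ map vL Ks ++ map vF Fs ++ filterᵇ isMidᵛ gadgetVertices

    length-references : length references ≡ 2 + 2 * nonEdgeCount + length clique
    length-references = begin
      length references
        ≡⟨ cong (2 +_) (trans (length-++ (map vL Ks)) (cong (length (map vL Ks) +_) (length-++ (map vF Fs)))) ⟩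
      2 + (length (map vL Ks) + (length (map vF Fs) + length (filterᵇ isMidᵛ gadgetVertices)))
        ≡⟨ cong₂ (λ a b → 2 + (a + b)) (length-map vL Ks) (cong₂ _+_ (length-map vF Fs) middles) ⟩
      2 + (length Ks + (length Fs + 2 * nonEdgeCount))
        ≡⟨ rearrange (length Ks) (length Fs) (2 * nonEdgeCount) ⟩
      2 + 2 * nonEdgeCount + (length Ks + length Fs)
        ≡⟨ cong (2 + 2 * nonEdgeCount +_) (length-combine Ks Fs) ⟨
      2 + 2 * nonEdgeCount + length clique
        ∎
      where
      open ≡-Reasoning
      middles : length (filterᵇ isMidᵛ gadgetVertices) ≡ 2 * nonEdgeCount
      middles = length-filterᵇ-overNonEdges gadget isMidᵛ 2 (λ _ _ _ → refl)
      rearrange : ∀ a b n → 2 + (a + (b + n)) ≡ 2 + n + (a + b)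
      rearrange = solve-∀

    middle∈references : ∀ {v} → v ∈ gadgetVertices → T (isMidᵛ v) → v ∈ references
    middle∈references v∈ mid =
      there (there (∈-++⁺ʳ (map vL Ks) (∈-++⁺ʳ (map vF Fs) (∈-filter⁺ (T? ∘ isMidᵛ) v∈ mid))))

    data Charge (x y : V′) : V′ → Set where
      b₁-pair       : y ≡ b₁ → isR x ≡ false → Charge x y a₁
      L-pair        : isL x ≡ true → isL y ≡ true → Charge x y a₁
      R-pair        : isR x ≡ true → Charge x y a₂
      b₂-pair       : y ≡ b₂ → Charge x y a₂
      u-pair        : ∀ {t} → x ≡ vF t → y ≡ u → Charge x y (vF t)
      K-pair        : ∀ {i} → y ≡ vR i → InK i → Charge x y (vL i)
      conflict-pair : ∀ {i j} (q : T (nonEdge j i)) → y ≡ vR i → vR j ∈ B →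
                      Charge x y (e (suc zero) j i q)
      gadget-pair   : ∀ {t t′ r i j q q′} → x ≡ e t i j q → y ≡ e t′ i j q′ → r ≡ t ⊎ r ≡ t′ →
                      T (isMid r) → Charge x y (e r i j q)

    charge-outside-R : ∀ {x y} → E′ x y → isR x ≡ false → y ∈ B → ∃ (Charge x y)
    charge-outside-R {y = vL _} adj Rx _ = a₁ , L-pair (L-neighbour refl adj Rx) refl
    charge-outside-R {y = a₁} adj Rx _ = a₁ , L-pair (L-neighbour refl adj Rx) refl
    charge-outside-R {y = a₂} adj Rx _ = a₁ , L-pair (L-neighbour refl adj Rx) refl
    charge-outside-R {y = vR i} _ _ i∈B with inK? i | conflict? i
    ... | yes K | _ = vL i , K-pair refl K
    ... | no _ | yes (j , q , j∈B) = e (suc zero) j i q , conflict-pair q refl j∈B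
    ... | no ¬K | no ¬conflict = ⊥-elim (¬K (i∈B , ¬conflict))
    charge-outside-R {y = b₁} _ Rx _ = a₁ , b₁-pair refl Rx
    charge-outside-R {y = b₂} _ _ _ = a₂ , b₂-pair refl
    charge-outside-R {y = u} adj Rx _ with u-neighbour adj Rx
    ... | t , refl = vF t , u-pair refl refl
    charge-outside-R {x} {y = vF _} adj Rx _ with () ← trans (sym (vF-neighbour {x} adj)) Rx
    charge-outside-R {x} {y = e t′ i j q′} adj Rx _ with e-neighbour {x} {t′} {i} {j} {q′} adj Rx
    ... | t , q , refl with adjacent-isMid (proj₂ (proj₂ (e-adj⁻ {t} {t′} {i} {i} {j} {j} {q} {q′} adj)))
    ...   | inj₁ mid = e t i j q , gadget-pair refl refl (inj₁ refl) mid
    ...   | inj₂ mid = e t′ i j q , gadget-pair refl refl (inj₂ refl) mid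

    charge : ∀ {x} (x∈A : x ∈ A) → ∃ (Charge x (mate x∈A))
    charge {x} x∈A with isR x in Rx
    ... | true = a₂ , R-pair Rx
    ... | false = charge-outside-R (mate-adj x∈A) Rx (mate∈B x∈A)

    charge-∈ : ∀ {x v} (x∈A : x ∈ A) → Charge x (mate x∈A) v → v ∈ references
    charge-∈ _ (b₁-pair _ _) = here refl
    charge-∈ _ (L-pair _ _) = here refl
    charge-∈ _ (R-pair _) = there (here refl)
    charge-∈ _ (b₂-pair _) = there (here refl)
    charge-∈ x∈A (u-pair refl y≡u) = there (there (∈-++⁺ʳ (map vL Ks) (∈-++⁺ˡ
      (∈-map⁺ vF (∈-filter⁺ inF? (∈-allFin _) (x∈A , subst (_∈ B) y≡u (mate∈B x∈A)))))))
    charge-∈ _ (K-pair _ K) = there (there (∈-++⁺ˡ (∈-map⁺ vL (∈-filter⁺ inK? (∈-allFin _) K))))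
    charge-∈ _ (conflict-pair q _ _) = middle∈references (∈-gadgetVertices (suc zero) _ _ q) _
    charge-∈ _ (gadget-pair _ _ _ mid) = middle∈references (∈-gadgetVertices _ _ _ _) mid

    L-to-L : ∀ {x x′} (x∈A : x ∈ A) (x′∈A : x′ ∈ A) → isL x ≡ true → isL (mate x′∈A) ≡ true →
      x ≡ x′
    L-to-L x∈A x′∈A Lx Ly = adjacent-to-mate x∈A x′∈A (L-clique Lx Ly (mate≢ x′∈A x∈A ∘ sym))

    R-to-R : ∀ {x x′} (x∈A : x ∈ A) (x′∈A : x′ ∈ A) → isR x ≡ true → isR (mate x′∈A) ≡ true →
      x ≡ x′
    R-to-R x∈A x′∈A Rx Ry = adjacent-to-mate x∈A x′∈A (R-clique Rx Ry (mate≢ x′∈A x∈A ∘ sym))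

    -- every gadget vertex is adjacent to v″_i or v″_j
    no-pair-inside : ∀ {x t t′ i j q q′} (x∈A : x ∈ A) → x ≡ e t i j q → mate x∈A ≡ e t′ i j q′ →
      vR i ∈ B → vR j ∈ B → ⊥
    no-pair-inside {t = t} {i = i} {j} {q} x∈A refl y≡ i∈B j∈B with touches-vR t {i} {j} {q}
    ... | inj₁ adj with () ← trans (mate-unique x∈A i∈B adj) y≡
    ... | inj₂ adj with () ← trans (mate-unique x∈A j∈B adj) y≡

    charge-injective : ∀ {x x′ v} (x∈A : x ∈ A) (x′∈A : x′ ∈ A) →
      Charge x (mate x∈A) v → Charge x′ (mate x′∈A) v → x ≡ x′
    charge-injective x∈A x′∈A (b₁-pair y≡ _) (b₁-pair y′≡ _) =
      mate-injective x∈A x′∈A (trans y≡ (sym y′≡))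
    charge-injective {x} x∈A x′∈A (b₁-pair y≡ Rx) (L-pair _ Ly′) =
      L-to-L x∈A x′∈A (cong isL (b₁-neighbour {x} (subst (E′ x) y≡ (mate-adj x∈A)) Rx)) Ly′
    charge-injective {x′ = x′} x∈A x′∈A (L-pair _ Ly) (b₁-pair y′≡ Rx′) =
      sym (L-to-L x′∈A x∈A (cong isL (b₁-neighbour {x′} (subst (E′ x′) y′≡ (mate-adj x′∈A)) Rx′)) Ly)
    charge-injective x∈A x′∈A (L-pair Lx _) (L-pair _ Ly′) = L-to-L x∈A x′∈A Lx Ly′
    charge-injective x∈A x′∈A (R-pair Rx) (R-pair Rx′) = R-to-R x∈A x′∈A Rx (R-mate x′∈A Rx′)
    charge-injective x∈A x′∈A (R-pair Rx) (b₂-pair y′≡) = R-to-R x∈A x′∈A Rx (cong isR y′≡)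
    charge-injective x∈A x′∈A (b₂-pair y≡) (R-pair Rx′) = sym (R-to-R x′∈A x∈A Rx′ (cong isR y≡))
    charge-injective x∈A x′∈A (b₂-pair y≡) (b₂-pair y′≡) =
      mate-injective x∈A x′∈A (trans y≡ (sym y′≡))
    charge-injective x∈A x′∈A (u-pair x≡ _) (u-pair x′≡ _) = trans x≡ (sym x′≡)
    charge-injective x∈A x′∈A (K-pair y≡ _) (K-pair y′≡ _) =
      mate-injective x∈A x′∈A (trans y≡ (sym y′≡))
    charge-injective x∈A x′∈A (conflict-pair _ y≡ _) (conflict-pair _ y′≡ _) =
      mate-injective x∈A x′∈A (trans y≡ (sym y′≡))
    charge-injective x∈A x′∈A (conflict-pair _ y≡ j∈B) (gadget-pair x′≡ y′≡ _ _) =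
      ⊥-elim (no-pair-inside x′∈A x′≡ y′≡ j∈B (subst (_∈ B) y≡ (mate∈B x∈A)))
    charge-injective x∈A x′∈A (gadget-pair x≡ y≡ _ _) (conflict-pair _ y′≡ j∈B) =
      ⊥-elim (no-pair-inside x∈A x≡ y≡ j∈B (subst (_∈ B) y′≡ (mate∈B x′∈A)))
    charge-injective x∈A x′∈A (gadget-pair x≡ y≡ r≡ _) (gadget-pair x′≡ y′≡ r′≡ _) =
      shared-vertex x∈A x′∈A (endpoint x≡ y≡ r≡) (endpoint x′≡ y′≡ r′≡)
      where
      endpoint : ∀ {x y t t′ r i j q q′} → x ≡ e t i j q → y ≡ e t′ i j q′ → r ≡ t ⊎ r ≡ t′ →
        e r i j q ≡ x ⊎ e r i j q ≡ y
      endpoint x≡ _ (inj₁ refl) = inj₁ (sym x≡)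
      endpoint _ y≡ (inj₂ refl) = inj₂ (trans e-irrelevant (sym y≡))

    length-A≤ : length A ≤ 2 + 2 * nonEdgeCount + length clique
    length-A≤ = subst (length A ≤_) length-references
      (injection⇒length≤ Unique-A (proj₁ ∘ charge) injective (λ x∈A → charge-∈ x∈A (proj₂ (charge x∈A))))
      where
      injective : ∀ {x x′} (x∈A : x ∈ A) (x′∈A : x′ ∈ A) → proj₁ (charge x∈A) ≡ proj₁ (charge x′∈A) →
        x ≡ x′
      injective x∈A x′∈A eq with charge x∈A | charge x′∈A
      ... | v , c | v′ , c′ with refl ← eq = charge-injective x∈A x′∈A c c′

    large-clique : ∀ {l} → length A ≡ 2 + 2 * nonEdgeCount + l → HasClique G l
    large-clique {l} |A| = cliqueList⇒HasClique G clique-IsClique (+-cancelˡ-≤ (2 + 2 * nonEdgeCount) l (length clique)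
      (subst (_≤ 2 + 2 * nonEdgeCount + length clique) |A| length-A≤))

  hasClique : ∀ l → HasPMS E′ (2 + 2 * nonEdgeCount + l) → HasClique G l
  hasClique l (A , B , uA , uB , |A| , |B| , A∩B≡∅ , one-in-B , one-in-A)
    with Any.any? (λ x → isR x Bool.≟ true) A
  ... | no A∌R =
    Charging.large-clique uA A∩B≡∅ one-in-B one-in-A (inj₁ λ x x∈A → ¬-not (A∌R ∘ lose x∈A)) |A|
  ... | yes A∋R =
    Charging.large-clique uB (λ y y∈B y∈A → A∩B≡∅ y y∈A y∈B) one-in-A one-in-B (inj₂ (find A∋R)) |B|

proposition3 : (k m : ℕ) (G : Graph (k + m)) → FirstIsVertexCover {k} {m} G →
    (l : ℕ) → 1 ≤ l →
    HasClique G l ⇔ HasPMS (Construction.E′ {k} {m} G) (2 + 2 * Construction.nonEdgeCount {k} {m} G + l)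
proposition3 k m G cover l _ = mk⇔
  (λ (f , f-injective , f-clique) → FromClique.hasPMS G cover f f-injective f-clique)
  (ToClique.hasClique G l)
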